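{- Let $H,H'\in\mathcal{T}_{\mathcal{H}}$ be encodings of Hydras and let $n$ be a natural number. If $\mathsf{A}(\mathsf{s}^n(\mathsf{0}),H)\to^{*}_{\mathcal{H}/\mathrm{AC}}\mathsf{A}(\mathsf{s}^{n+1}(\mathsf{0}),H')$, then $H$ and $H'$ are successive Hydras in a battle, i.e. $H'$ encodes a Hydra obtained by a battle step at stage $n$ from the Hydra encoded by $H$.
   Context: Terms are built from variables and the function symbols: constants $\mathsf{h},\mathsf{0}$; unary $\mathsf{I},\mathsf{E},\mathsf{s}$; binary $\mathsf{A},\mathsf{B},\mathsf{C},\mathsf{D}$ and binary $\mid$ written infix. $=_{\mathrm{AC}}$ is the congruence generated by associativity and commutativity of $\mid$. For a set $\mathcal{R}$ of rules, $\to_{\mathcal{R}}$ is its closure under substitutions and contexts and $\to_{\mathcal{R}/\mathrm{AC}}={=_{\mathrm{AC}}}\cdot{\to_{\mathcal{R}}}\cdot{=_{\mathrm{AC}}}$; $\to^*$ denotes the reflexive transitive closure. The TRS $\mathcal{H}$ consists of the rules: (1) $\mathsf{A}(n,\mathsf{I}(\mathsf{h}))\to\mathsf{A}(\mathsf{s}(n),\mathsf{h})$; (2) $\mathsf{A}(n,\mathsf{I}(\mathsf{h}\mid x))\to\mathsf{A}(\mathsf{s}(n),\mathsf{I}(x))$; (3) $\mathsf{A}(n,\mathsf{I}(x))\to\mathsf{B}(n,\mathsf{D}(\mathsf{s}(n),\mathsf{I}(x)))$; (4) $\mathsf{C}(\mathsf{0},x)\to\mathsf{E}(x)$; (5) $\mathsf{C}(\mathsf{s}(n),x)\to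 x\mid\mathsf{C}(n,x)$; (6) $\mathsf{I}(\mathsf{E}(x)\mid y)\to\mathsf{E}(\mathsf{I}(x\mid y))$; (7) $\mathsf{I}(\mathsf{E}(x))\to\mathsf{E}(\mathsf{I}(x))$; (8) $\mathsf{D}(n,\mathsf{I}(\mathsf{I}(x)))\to\mathsf{I}(\mathsf{D}(n,\mathsf{I}(x)))$; (9) $\mathsf{D}(n,\mathsf{I}(\mathsf{I}(x)\mid y))\to\mathsf{I}(\mathsf{D}(n,\mathsf{I}(x))\mid y)$; (10) $\mathsf{D}(n,\mathsf{I}(\mathsf{I}(\mathsf{h}\mid x)\mid y))\to\mathsf{I}(\mathsf{C}(n,\mathsf{I}(x))\mid y)$; (11) $\mathsf{D}(n,\mathsf{I}(\mathsf{I}(\mathsf{h}\mid x)))\to\mathsf{I}(\mathsf{C}(n,\mathsf{I}(x)))$; (12) $\mathsf{D}(n,\mathsf{I}(\mathsf{I}(\mathsf{h})\mid y))\to\mathsf{I}(\mathsf{C}(n,\mathsf{h})\mid y)$; (13) $\mathsf{D}(n,\mathsf{I}(\mathsf{I}(\mathsf{h})))\to\mathsf{I}(\mathsf{C}(n,\mathsf{h}))$; (14) $\mathsf{B}(n,\mathsf{E}(x))\to\mathsf{A}(\mathsf{s}(n),x)$. $\mathcal{T}_{\mathcal{H}}$ is the set of ground terms over $\{\mathsf{h},\mathsf{I},\mid\}$. A Hydra is a finite rooted unordered tree; its heads are its leaves other than the root. An encoding of a Hydra: a single node is encoded as $\mathsf{h}$, and a node whose subtrees are $T_1,\dots,T_k$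 ($k\ge1$) is encoded as $\mathsf{I}(t_1\mid\cdots\mid t_k)$ with $t_i$ an encoding of $T_i$ (unique up to $=_{\mathrm{AC}}$). A battle step at stage $n$ transforms a Hydra $T$ with at least one head into $T'$: choose any head $\ell$, with parent $p$, and delete $\ell$; if $p$ is the root, the result is $T'$; otherwise, with $g$ the parent of $p$ and $P$ the subtree rooted at $p$ after deletion, $T'$ is obtained by replacing $P$, as a child subtree of $g$, by $n+2$ copies of $P$. In a battle $T_0,T_1,\dots$, $T_{n+1}$ arises from $T_n$ by a battle step at stage $n$; $T_n,T_{n+1}$ are successive Hydras. -}

module Defs where

open import Data.Nat using (ℕ; zero; suc; _+_)
open import Data.List using (List; []; _∷_; _++_; replicate)
open import Data.List.Membership.Propositional using (_∈_)
open import Data.Product using (Σ; ∃; _×_; _,_)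
open import Relation.Binary.PropositionalEquality using (_≡_)
open import Relation.Binary.Construct.Closure.ReflexiveTransitive using (Star)

infixr 5 _∣_

data Term : Set where
  var : ℕ → Term
  h 𝟘 : Term
  I E s : Term → Term
  A B C D _∣_ : Term → Term → Term

sub : (ℕ → Term) → Term → Term
sub σ (var x) = σ x
sub σ h = h
sub σ 𝟘 = 𝟘
sub σ (I t) = I (sub σ t)
sub σ (E t) = E (sub σ t)
sub σ (s t) = s (sub σ t)
sub σ (A t u) = A (sub σ t) (sub σ u)
sub σ (B t u) = B (sub σ t) (sub σ u)
sub σ (C t u) = C (sub σ t) (sub σ u)
sub σ (D t u) = D (sub σ t) (sub σ u)
sub σ (t ∣ u) = sub σ t ∣ sub σ u

sⁿ0 : ℕ → Term
sⁿ0 zero = 𝟘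
sⁿ0 (suc n) = s (sⁿ0 n)

data CC (R : Term → Term → Set) : Term → Term → Set where
  base : ∀ {t u} → R t u → CC R t u
  I-cong : ∀ {t u} → CC R t u → CC R (I t) (I u)
  E-cong : ∀ {t u} → CC R t u → CC R (E t) (E u)
  s-cong : ∀ {t u} → CC R t u → CC R (s t) (s u)
  A-congˡ : ∀ {t u v} → CC R t u → CC R (A t v) (A u v)
  A-congʳ : ∀ {t u v} → CC R t u → CC R (A v t) (A v u)
  B-congˡ : ∀ {t u v} → CC R t u → CC R (B t v) (B u v)
  B-congʳ : ∀ {t u v} → CC R t u → CC R (B v t) (B v u)
  C-congˡ : ∀ {t u v} → CC R t u → CC R (C t v) (C u v)
  C-congʳ : ∀ {t u v} → CC R t u → CC R (C v t) (C v u)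
  D-congˡ : ∀ {t u v} → CC R t u → CC R (D t v) (D u v)
  D-congʳ : ∀ {t u v} → CC R t u → CC R (D v t) (D v u)
  ∣-congˡ : ∀ {t u v} → CC R t u → CC R (t ∣ v) (u ∣ v)
  ∣-congʳ : ∀ {t u v} → CC R t u → CC R (v ∣ t) (v ∣ u)

data ACAxiom : Term → Term → Set where
  assoc : ∀ x y z → ACAxiom (x ∣ (y ∣ z)) ((x ∣ y) ∣ z)
  comm  : ∀ x y → ACAxiom (x ∣ y) (y ∣ x)

data ACStep : Term → Term → Set where
  fwd : ∀ {t u} → CC ACAxiom t u → ACStep t u
  bwd : ∀ {t u} → CC ACAxiom u t → ACStep t u

_=AC_ : Term → Term → Set
_=AC_ = Star ACStep

record Rule : Set where
  constructor _⇒_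
  field
    lhs rhs : Term

private
  n x y : Term
  n = var 0
  x = var 1
  y = var 2

ℋ : List Rule
ℋ =
    (A n (I h) ⇒ A (s n) h)
  ∷ (A n (I (h ∣ x)) ⇒ A (s n) (I x))
  ∷ (A n (I x) ⇒ B n (D (s n) (I x)))
  ∷ (C 𝟘 x ⇒ E x)
  ∷ (C (s n) x ⇒ (x ∣ C n x))
  ∷ (I (E x ∣ y) ⇒ E (I (x ∣ y)))
  ∷ (I (E x) ⇒ E (I x))
  ∷ (D n (I (I x)) ⇒ I (D n (I x)))
  ∷ (D n (I (I x ∣ y)) ⇒ I (D n (I x) ∣ y))
  ∷ (D n (I (I (h ∣ x) ∣ y)) ⇒ I (C n (I x) ∣ y))
  ∷ (D n (I (I (h ∣ x))) ⇒ I (C n (I x)))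
  ∷ (D n (I (I h ∣ y)) ⇒ I (C n h ∣ y))
  ∷ (D n (I (I h)) ⇒ I (C n h))
  ∷ (B n (E x) ⇒ A (s n) x)
  ∷ []

data RootStep (R : List Rule) : Term → Term → Set where
  inst : ∀ {l r} → (l ⇒ r) ∈ R → (σ : ℕ → Term) →
         RootStep R (sub σ l) (sub σ r)

_⟶[_]_ : Term → List Rule → Term → Set
t ⟶[ R ] u = CC (RootStep R) t u

_⟶[_/AC]_ : Term → List Rule → Term → Set
t ⟶[ R /AC] u = Σ Term λ t' → Σ Term λ u' →
  (t =AC t') × (t' ⟶[ R ] u') × (u' =AC u)

_⟶*[_/AC]_ : Term → List Rule → Term → Set
t ⟶*[ R /AC] u = Star (λ a b → a ⟶[ R /AC] b) t u

-- Hydras: finite rooted trees; children are listed in some order, but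
-- the order is irrelevant for everything below (encoding is up to AC,
-- and battle steps may act on any child position).

data Hydra : Set where
  node : List Hydra → Hydra

mutual
  enc : Hydra → Term
  enc (node []) = h
  enc (node (c ∷ cs)) = I (encList c cs)

  encList : Hydra → List Hydra → Term
  encList c [] = enc c
  encList c (d ∷ ds) = enc c ∣ encList d ds

-- t is an encoding of the Hydra T (encodings are unique up to =AC)
Encodes : Term → Hydra → Set
Encodes t T = t =AC enc T

leaf : Hydra
leaf = node []

-- Constructors describe the position of the chosen head ℓ:
--  * root-head : ℓ is a child of the root (parent p is the root); ℓ is deleted.
--  * grow      : the current node is g, its child p = node (us ++ leaf ∷ vs)
--                has the chosen head ℓ as child; ℓ is deleted, giving P, and
--                P (as a child of g) is replaced by n+2 copies of P.
--  * deeper    : the step (grow) happens inside a child subtree.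
mutual
  data BattleStep (n : ℕ) : Hydra → Hydra → Set where
    root-head : ∀ xs ys →
      BattleStep n (node (xs ++ leaf ∷ ys)) (node (xs ++ ys))
    inner : ∀ {T T'} → InnerStep n T T' → BattleStep n T T'

  -- a battle step whose chosen head has a non-root parent p, located in
  -- the subtree rooted at the given node, with g inside that subtree
  data InnerStep (n : ℕ) : Hydra → Hydra → Set where
    grow : ∀ xs ys us vs →
      InnerStep n (node (xs ++ node (us ++ leaf ∷ vs) ∷ ys))
                  (node (xs ++ replicate (n + 2) (node (us ++ vs)) ++ ys))
    deeper : ∀ xs ys {c c'} → InnerStep n c c' →
      InnerStep n (node (xs ++ c ∷ ys)) (node (xs ++ c' ∷ ys))

-- Either rule (1) or (2) removes a head at the root, or rule (3) starts a D that walks down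
-- the tree (rules (8), (9)) until it reaches a node g with a child p carrying a head; rules
-- (10)-(13) delete the head and leave C(sⁿ⁺¹(0), P), which unfolds into n + 2 copies of P
-- (rules (5), (4)), and the resulting E climbs back to the root (rules (6), (7)), where (14)
-- resumes A with the counter increased. This is tracked by an invariant on every reachable
-- term: while D travels, erasing it gives back H; once C has appeared, performing all pending
-- copies gives a successor of H. Both readings are invariant under AC, terms of 𝒯_ℋ are
-- normal forms, and every other path overshoots the counter sⁿ⁺¹(0).
{-# OPTIONS --safe #-}
module Submission where

open import Defs
open import Data.Nat using (ℕ; zero; suc; _+_; _≤_; s≤s)
open import Data.Nat.Properties using (+-comm; ≤-refl; ≤-trans; m≤n⇒m≤1+n; n≤1+n; 1+n≰n; 1+n≢n)
open import Data.Product using (Σ; _×_; _,_; proj₁; proj₂)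
open import Data.Sum using (_⊎_; inj₁; inj₂)
open import Data.Empty using (⊥-elim)
open import Data.List using (List; []; _∷_; _++_; replicate)
open import Data.List.Properties using (++-assoc; ++-identityʳ)
open import Data.List.Relation.Unary.Any using (here; there)
open import Function using (flip)
open import Relation.Nullary using (¬_)
open import Relation.Binary.PropositionalEquality using (_≡_; refl; sym; cong; cong₂; subst; subst₂)
open import Relation.Binary.Construct.Closure.ReflexiveTransitive using (ε; _◅_; _◅◅_; gmap; reverse)

CC-map : ∀ {R Q : Term → Term → Set} → (∀ {a b} → R a b → Q a b) → ∀ {a b} → CC R a b → CC Q a b
CC-map f (base r) = base (f r)
CC-map f (I-cong c) = I-cong (CC-map f c)
CC-map f (E-cong c) = E-cong (CC-map f c)
CC-map f (s-cong c) = s-cong (CC-map f c)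
CC-map f (A-congˡ c) = A-congˡ (CC-map f c)
CC-map f (A-congʳ c) = A-congʳ (CC-map f c)
CC-map f (B-congˡ c) = B-congˡ (CC-map f c)
CC-map f (B-congʳ c) = B-congʳ (CC-map f c)
CC-map f (C-congˡ c) = C-congˡ (CC-map f c)
CC-map f (C-congʳ c) = C-congʳ (CC-map f c)
CC-map f (D-congˡ c) = D-congˡ (CC-map f c)
CC-map f (D-congʳ c) = D-congʳ (CC-map f c)
CC-map f (∣-congˡ c) = ∣-congˡ (CC-map f c)
CC-map f (∣-congʳ c) = ∣-congʳ (CC-map f c)

CC-reverse : ∀ {R : Term → Term → Set} {a b} → CC R a b → CC (flip R) b a
CC-reverse (base r) = base r
CC-reverse (I-cong c) = I-cong (CC-reverse c)
CC-reverse (E-cong c) = E-cong (CC-reverse c)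
CC-reverse (s-cong c) = s-cong (CC-reverse c)
CC-reverse (A-congˡ c) = A-congˡ (CC-reverse c)
CC-reverse (A-congʳ c) = A-congʳ (CC-reverse c)
CC-reverse (B-congˡ c) = B-congˡ (CC-reverse c)
CC-reverse (B-congʳ c) = B-congʳ (CC-reverse c)
CC-reverse (C-congˡ c) = C-congˡ (CC-reverse c)
CC-reverse (C-congʳ c) = C-congʳ (CC-reverse c)
CC-reverse (D-congˡ c) = D-congˡ (CC-reverse c)
CC-reverse (D-congʳ c) = D-congʳ (CC-reverse c)
CC-reverse (∣-congˡ c) = ∣-congˡ (CC-reverse c)
CC-reverse (∣-congʳ c) = ∣-congʳ (CC-reverse c)

-- An ACStep with its direction pushed below the context, so that invariance
-- under =AC needs only one induction over the position of the step.
ACRewrite : Term → Term → Set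
ACRewrite = CC (λ a b → ACAxiom a b ⊎ ACAxiom b a)

ACStep⇒ACRewrite : ∀ {a b} → ACStep a b → ACRewrite a b
ACStep⇒ACRewrite (fwd c) = CC-map inj₁ c
ACStep⇒ACRewrite (bwd c) = CC-map inj₂ (CC-reverse c)

ACStep-sym : ∀ {a b} → ACStep a b → ACStep b a
ACStep-sym (fwd c) = bwd c
ACStep-sym (bwd c) = fwd c

ACStep-cong : (f : Term → Term) → (∀ {a b} → CC ACAxiom a b → CC ACAxiom (f a) (f b)) →
              ∀ {a b} → ACStep a b → ACStep (f a) (f b)
ACStep-cong f f-cong (fwd c) = fwd (f-cong c)
ACStep-cong f f-cong (bwd c) = bwd (f-cong c)

ACRewrite⇒ACStep : ∀ {a b} → ACRewrite a b → ACStep a b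
ACRewrite⇒ACStep (base (inj₁ r)) = fwd (base r)
ACRewrite⇒ACStep (base (inj₂ r)) = bwd (base r)
ACRewrite⇒ACStep (I-cong c) = ACStep-cong I I-cong (ACRewrite⇒ACStep c)
ACRewrite⇒ACStep (E-cong c) = ACStep-cong E E-cong (ACRewrite⇒ACStep c)
ACRewrite⇒ACStep (s-cong c) = ACStep-cong s s-cong (ACRewrite⇒ACStep c)
ACRewrite⇒ACStep (A-congˡ {v = v} c) = ACStep-cong (λ z → A z v) A-congˡ (ACRewrite⇒ACStep c)
ACRewrite⇒ACStep (A-congʳ {v = v} c) = ACStep-cong (A v) A-congʳ (ACRewrite⇒ACStep c)
ACRewrite⇒ACStep (B-congˡ {v = v} c) = ACStep-cong (λ z → B z v) B-congˡ (ACRewrite⇒ACStep c)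
ACRewrite⇒ACStep (B-congʳ {v = v} c) = ACStep-cong (B v) B-congʳ (ACRewrite⇒ACStep c)
ACRewrite⇒ACStep (C-congˡ {v = v} c) = ACStep-cong (λ z → C z v) C-congˡ (ACRewrite⇒ACStep c)
ACRewrite⇒ACStep (C-congʳ {v = v} c) = ACStep-cong (C v) C-congʳ (ACRewrite⇒ACStep c)
ACRewrite⇒ACStep (D-congˡ {v = v} c) = ACStep-cong (λ z → D z v) D-congˡ (ACRewrite⇒ACStep c)
ACRewrite⇒ACStep (D-congʳ {v = v} c) = ACStep-cong (D v) D-congʳ (ACRewrite⇒ACStep c)
ACRewrite⇒ACStep (∣-congˡ {v = v} c) = ACStep-cong (_∣ v) ∣-congˡ (ACRewrite⇒ACStep c)
ACRewrite⇒ACStep (∣-congʳ {v = v} c) = ACStep-cong (v ∣_) ∣-congʳ (ACRewrite⇒ACStep c)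

ACRewrite⇒=AC : ∀ {a b} → ACRewrite a b → a =AC b
ACRewrite⇒=AC c = ACRewrite⇒ACStep c ◅ ε

=AC-sym : ∀ {a b} → a =AC b → b =AC a
=AC-sym = reverse ACStep-sym

=AC-cong : (f : Term → Term) → (∀ {a b} → CC ACAxiom a b → CC ACAxiom (f a) (f b)) →
           ∀ {a b} → a =AC b → f a =AC f b
=AC-cong f f-cong = gmap f (ACStep-cong f f-cong)

=AC-∣ˡ : ∀ {a b} v → a =AC b → (a ∣ v) =AC (b ∣ v)
=AC-∣ˡ v = =AC-cong (_∣ v) ∣-congˡ

=AC-∣ʳ : ∀ {a b} v → a =AC b → (v ∣ a) =AC (v ∣ b)
=AC-∣ʳ v = =AC-cong (v ∣_) ∣-congʳ

data ℋ-Root : Term → Term → Set where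
  r1  : ∀ k → ℋ-Root (A k (I h)) (A (s k) h)
  r2  : ∀ k x → ℋ-Root (A k (I (h ∣ x))) (A (s k) (I x))
  r3  : ∀ k x → ℋ-Root (A k (I x)) (B k (D (s k) (I x)))
  r4  : ∀ x → ℋ-Root (C 𝟘 x) (E x)
  r5  : ∀ k x → ℋ-Root (C (s k) x) (x ∣ C k x)
  r6  : ∀ x y → ℋ-Root (I (E x ∣ y)) (E (I (x ∣ y)))
  r7  : ∀ x → ℋ-Root (I (E x)) (E (I x))
  r8  : ∀ k x → ℋ-Root (D k (I (I x))) (I (D k (I x)))
  r9  : ∀ k x y → ℋ-Root (D k (I (I x ∣ y))) (I (D k (I x) ∣ y))
  r10 : ∀ k x y → ℋ-Root (D k (I (I (h ∣ x) ∣ y))) (I (C k (I x) ∣ y))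
  r11 : ∀ k x → ℋ-Root (D k (I (I (h ∣ x)))) (I (C k (I x)))
  r12 : ∀ k y → ℋ-Root (D k (I (I h ∣ y))) (I (C k h ∣ y))
  r13 : ∀ k → ℋ-Root (D k (I (I h))) (I (C k h))
  r14 : ∀ k x → ℋ-Root (B k (E x)) (A (s k) x)

RootStep⇒ℋ-Root : ∀ {t u} → RootStep ℋ t u → ℋ-Root t u
RootStep⇒ℋ-Root (inst (here refl) σ) = r1 (σ 0)
RootStep⇒ℋ-Root (inst (there (here refl)) σ) = r2 (σ 0) (σ 1)
RootStep⇒ℋ-Root (inst (there (there (here refl))) σ) = r3 (σ 0) (σ 1)
RootStep⇒ℋ-Root (inst (there (there (there (here refl)))) σ) = r4 (σ 1)
RootStep⇒ℋ-Root (inst (there (there (there (there (here refl))))) σ) = r5 (σ 0) (σ 1)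
RootStep⇒ℋ-Root (inst (there (there (there (there (there (here refl)))))) σ) = r6 (σ 1) (σ 2)
RootStep⇒ℋ-Root (inst (there (there (there (there (there (there (here refl))))))) σ) = r7 (σ 1)
RootStep⇒ℋ-Root (inst (there (there (there (there (there (there (there (here refl)))))))) σ) = r8 (σ 0) (σ 1)
RootStep⇒ℋ-Root (inst (there (there (there (there (there (there (there (there (here refl))))))))) σ) = r9 (σ 0) (σ 1) (σ 2)
RootStep⇒ℋ-Root (inst (there (there (there (there (there (there (there (there (there (here refl)))))))))) σ) = r10 (σ 0) (σ 1) (σ 2)
RootStep⇒ℋ-Root (inst (there (there (there (there (there (there (there (there (there (there (here refl))))))))))) σ) = r11 (σ 0) (σ 1)
RootStep⇒ℋ-Root (inst (there (there (there (there (there (there (there (there (there (there (there (here refl)))))))))))) σ) = r12 (σ 0) (σ 2)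
RootStep⇒ℋ-Root (inst (there (there (there (there (there (there (there (there (there (there (there (there (here refl))))))))))))) σ) = r13 (σ 0)
RootStep⇒ℋ-Root (inst (there (there (there (there (there (there (there (there (there (there (there (there (there (here refl)))))))))))))) σ) = r14 (σ 0) (σ 1)
RootStep⇒ℋ-Root (inst (there (there (there (there (there (there (there (there (there (there (there (there (there (there ())))))))))))))) _)

ℋRewrite : Term → Term → Set
ℋRewrite = CC ℋ-Root

-- Pure t says t ∈ 𝒯_ℋ.
data Pure : Term → Set where
  ph : Pure h
  pI : ∀ {t} → Pure t → Pure (I t)
  p∣ : ∀ {a b} → Pure a → Pure b → Pure (a ∣ b)

data Numeral : Term → Set where
  num-𝟘 : Numeral 𝟘
  num-s : ∀ {k} → Numeral k → Numeral (s k)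

numeral : ∀ m → Numeral (sⁿ0 m)
numeral zero = num-𝟘
numeral (suc m) = num-s (numeral m)

Numeral-AC-normal : ∀ {k k'} → Numeral k → ¬ ACRewrite k k'
Numeral-AC-normal num-𝟘 (base (inj₁ ()))
Numeral-AC-normal num-𝟘 (base (inj₂ ()))
Numeral-AC-normal (num-s _) (base (inj₁ ()))
Numeral-AC-normal (num-s _) (base (inj₂ ()))
Numeral-AC-normal (num-s k) (s-cong c) = Numeral-AC-normal k c

Numeral-ℋ-normal : ∀ {k k'} → Numeral k → ¬ ℋRewrite k k'
Numeral-ℋ-normal num-𝟘 (base ())
Numeral-ℋ-normal (num-s _) (base ())
Numeral-ℋ-normal (num-s k) (s-cong c) = Numeral-ℋ-normal k c

Pure-ℋ-normal : ∀ {t u} → Pure t → ¬ ℋRewrite t u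
Pure-ℋ-normal (pI (p∣ () _)) (base (r6 _ _))
Pure-ℋ-normal (pI p) (I-cong c) = Pure-ℋ-normal p c
Pure-ℋ-normal (p∣ pa _) (∣-congˡ c) = Pure-ℋ-normal pa c
Pure-ℋ-normal (p∣ _ pb) (∣-congʳ c) = Pure-ℋ-normal pb c

Pure-resp-ACRewrite : ∀ {t u} → ACRewrite t u → Pure t → Pure u
Pure-resp-ACRewrite (base (inj₁ (assoc _ _ _))) (p∣ pa (p∣ pb pc)) = p∣ (p∣ pa pb) pc
Pure-resp-ACRewrite (base (inj₁ (comm _ _))) (p∣ pa pb) = p∣ pb pa
Pure-resp-ACRewrite (base (inj₂ (assoc _ _ _))) (p∣ (p∣ pa pb) pc) = p∣ pa (p∣ pb pc)
Pure-resp-ACRewrite (base (inj₂ (comm _ _))) (p∣ pa pb) = p∣ pb pa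
Pure-resp-ACRewrite (I-cong c) (pI p) = pI (Pure-resp-ACRewrite c p)
Pure-resp-ACRewrite (∣-congˡ c) (p∣ pa pb) = p∣ (Pure-resp-ACRewrite c pa) pb
Pure-resp-ACRewrite (∣-congʳ c) (p∣ pa pb) = p∣ pa (Pure-resp-ACRewrite c pb)

Pure-resp-=AC : ∀ {t u} → t =AC u → Pure t → Pure u
Pure-resp-=AC ε p = p
Pure-resp-=AC (c ◅ cs) p = Pure-resp-=AC cs (Pure-resp-ACRewrite (ACStep⇒ACRewrite c) p)

mutual
  enc-Pure : ∀ T → Pure (enc T)
  enc-Pure (node []) = ph
  enc-Pure (node (c ∷ cs)) = pI (encList-Pure c cs)

  encList-Pure : ∀ c cs → Pure (encList c cs)
  encList-Pure c [] = enc-Pure c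
  encList-Pure c (d ∷ ds) = p∣ (enc-Pure c) (encList-Pure d ds)

-- Junk value: decode reads every term that is not of the form I t as a single node.
mutual
  decode : Term → Hydra
  decode (I t) = node (decodeChildren t)
  decode _ = leaf

  decodeChildren : Term → List Hydra
  decodeChildren (a ∣ b) = decodeChildren a ++ decodeChildren b
  decodeChildren t = decode t ∷ []

encList-++ : ∀ c cs d ds → (encList c cs ∣ encList d ds) =AC encList c (cs ++ d ∷ ds)
encList-++ c [] d ds = ε
encList-++ c (c' ∷ cs) d ds = bwd (base (assoc _ _ _)) ◅ =AC-∣ʳ (enc c) (encList-++ c' cs d ds)

mutual
  decode-encodes : ∀ {t} → Pure t → Encodes (I t) (decode (I t))
  decode-encodes p with decodeChildren-encodes p
  ... | c , cs , e , t≈ rewrite e = =AC-cong I I-cong t≈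

  decodeChildren-encodes : ∀ {t} → Pure t →
    Σ Hydra λ c → Σ (List Hydra) λ cs → decodeChildren t ≡ c ∷ cs × t =AC encList c cs
  decodeChildren-encodes ph = leaf , [] , refl , ε
  decodeChildren-encodes (pI p) = _ , [] , refl , decode-encodes p
  decodeChildren-encodes {a ∣ b} (p∣ pa pb) with decodeChildren-encodes pa | decodeChildren-encodes pb
  ... | c , cs , e , a≈ | d , ds , e' , b≈ =
    c , cs ++ d ∷ ds , cong₂ _++_ e e' ,
    (=AC-∣ˡ b a≈ ◅◅ =AC-∣ʳ (encList c cs) b≈ ◅◅ encList-++ c cs d ds)

split-++ʳ : ∀ {L M M' xs ys} {c : Hydra} → L ≡ xs ++ c ∷ ys → M ≡ M' → L ++ M ≡ xs ++ c ∷ (ys ++ M')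
split-++ʳ {xs = xs} {ys} {c} refl refl = ++-assoc xs (c ∷ ys) _

split-++ˡ : ∀ {L M M' xs ys} {c : Hydra} → M ≡ M' → L ≡ xs ++ c ∷ ys → M ++ L ≡ (M' ++ xs) ++ c ∷ ys
split-++ˡ {M = M} {xs = xs} {ys} {c} refl refl = sym (++-assoc M xs (c ∷ ys))

Marked : (Term → Set) → Term → Set
Marked S (I t) = Marked S t
Marked S (a ∣ b) = (Marked S a × Pure b) ⊎ (Pure a × Marked S b)
Marked S t = S t

Marked-resp-ACRewrite : ∀ {S : Term → Set} → (∀ {t u} → ACRewrite t u → S t → S u) →
                        ∀ {t u} → ACRewrite t u → Marked S t → Marked S u
Marked-resp-ACRewrite S-resp (base (inj₁ (assoc _ _ _))) (inj₁ (m , p∣ py pz)) = inj₁ (inj₁ (m , py) , pz)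
Marked-resp-ACRewrite S-resp (base (inj₁ (assoc _ _ _))) (inj₂ (px , inj₁ (m , pz))) = inj₁ (inj₂ (px , m) , pz)
Marked-resp-ACRewrite S-resp (base (inj₁ (assoc _ _ _))) (inj₂ (px , inj₂ (py , m))) = inj₂ (p∣ px py , m)
Marked-resp-ACRewrite S-resp (base (inj₂ (assoc _ _ _))) (inj₁ (inj₁ (m , py) , pz)) = inj₁ (m , p∣ py pz)
Marked-resp-ACRewrite S-resp (base (inj₂ (assoc _ _ _))) (inj₁ (inj₂ (px , m) , pz)) = inj₂ (px , inj₁ (m , pz))
Marked-resp-ACRewrite S-resp (base (inj₂ (assoc _ _ _))) (inj₂ (p∣ px py , m)) = inj₂ (px , inj₂ (py , m))
Marked-resp-ACRewrite S-resp (base (inj₁ (comm _ _))) (inj₁ (m , p)) = inj₂ (p , m)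
Marked-resp-ACRewrite S-resp (base (inj₁ (comm _ _))) (inj₂ (p , m)) = inj₁ (m , p)
Marked-resp-ACRewrite S-resp (base (inj₂ (comm _ _))) (inj₁ (m , p)) = inj₂ (p , m)
Marked-resp-ACRewrite S-resp (base (inj₂ (comm _ _))) (inj₂ (p , m)) = inj₁ (m , p)
Marked-resp-ACRewrite S-resp (I-cong c) m = Marked-resp-ACRewrite S-resp c m
Marked-resp-ACRewrite S-resp (∣-congˡ c) (inj₁ (m , p)) = inj₁ (Marked-resp-ACRewrite S-resp c m , p)
Marked-resp-ACRewrite S-resp (∣-congˡ c) (inj₂ (p , m)) = inj₂ (Pure-resp-ACRewrite c p , m)
Marked-resp-ACRewrite S-resp (∣-congʳ c) (inj₁ (m , p)) = inj₁ (m , Pure-resp-ACRewrite c p)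
Marked-resp-ACRewrite S-resp (∣-congʳ c) (inj₂ (p , m)) = inj₂ (p , Marked-resp-ACRewrite S-resp c m)
Marked-resp-ACRewrite S-resp c@(E-cong _) m = S-resp c m
Marked-resp-ACRewrite S-resp c@(s-cong _) m = S-resp c m
Marked-resp-ACRewrite S-resp c@(A-congˡ _) m = S-resp c m
Marked-resp-ACRewrite S-resp c@(A-congʳ _) m = S-resp c m
Marked-resp-ACRewrite S-resp c@(B-congˡ _) m = S-resp c m
Marked-resp-ACRewrite S-resp c@(B-congʳ _) m = S-resp c m
Marked-resp-ACRewrite S-resp c@(C-congˡ _) m = S-resp c m
Marked-resp-ACRewrite S-resp c@(C-congʳ _) m = S-resp c m
Marked-resp-ACRewrite S-resp c@(D-congˡ _) m = S-resp c m
Marked-resp-ACRewrite S-resp c@(D-congʳ _) m = S-resp c m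

eraseD : Term → Term
eraseD (D _ w) = eraseD w
eraseD (I t) = I (eraseD t)
eraseD (a ∣ b) = eraseD a ∣ eraseD b
eraseD t = t

-- copies (sᵐ 0) q is q ∣ ⋯ ∣ q with m + 1 copies: what C(sᵐ 0, q) unfolds to by rules (5) and (4).
copies : Term → Term → Term
copies (s k) q = q ∣ copies k q
copies _ q = q

expandC : Term → Term
expandC (C k q) = copies k (expandC q)
expandC (E q) = expandC q
expandC (I t) = I (expandC t)
expandC (a ∣ b) = expandC a ∣ expandC b
expandC t = t

eraseD-Pure : ∀ {t} → Pure t → eraseD t ≡ t
eraseD-Pure ph = refl
eraseD-Pure (pI p) = cong I (eraseD-Pure p)
eraseD-Pure (p∣ p q) = cong₂ _∣_ (eraseD-Pure p) (eraseD-Pure q)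

expandC-Pure : ∀ {t} → Pure t → expandC t ≡ t
expandC-Pure ph = refl
expandC-Pure (pI p) = cong I (expandC-Pure p)
expandC-Pure (p∣ p q) = cong₂ _∣_ (expandC-Pure p) (expandC-Pure q)

Pure-eraseD : ∀ {t} → Pure t → Pure (eraseD t)
Pure-eraseD p = subst Pure (sym (eraseD-Pure p)) p

Pure-copies : ∀ {k q} → Numeral k → Pure q → Pure (copies k q)
Pure-copies num-𝟘 p = p
Pure-copies (num-s k) p = p∣ p (Pure-copies k p)

copies-resp-=AC : ∀ {k a b} → Numeral k → a =AC b → copies k a =AC copies k b
copies-resp-=AC num-𝟘 a≈b = a≈b
copies-resp-=AC {s k} {a} {b} (num-s nk) a≈b =
  =AC-∣ˡ (copies k a) a≈b ◅◅ =AC-∣ʳ b (copies-resp-=AC nk a≈b)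

decodeChildren-copies : ∀ m {q c} → decodeChildren q ≡ c ∷ [] →
                        decodeChildren (copies (sⁿ0 m) q) ≡ replicate (suc m) c
decodeChildren-copies zero e = e
decodeChildren-copies (suc m) e = cong₂ _++_ e (decodeChildren-copies m e)

eraseD-resp-ACRewrite : ∀ {t u} → ACRewrite t u → eraseD t =AC eraseD u
eraseD-resp-ACRewrite (base (inj₁ (assoc _ _ _))) = ACRewrite⇒=AC (base (inj₁ (assoc _ _ _)))
eraseD-resp-ACRewrite (base (inj₁ (comm _ _))) = ACRewrite⇒=AC (base (inj₁ (comm _ _)))
eraseD-resp-ACRewrite (base (inj₂ (assoc _ _ _))) = ACRewrite⇒=AC (base (inj₂ (assoc _ _ _)))
eraseD-resp-ACRewrite (base (inj₂ (comm _ _))) = ACRewrite⇒=AC (base (inj₂ (comm _ _)))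
eraseD-resp-ACRewrite (I-cong c) = =AC-cong I I-cong (eraseD-resp-ACRewrite c)
eraseD-resp-ACRewrite (∣-congˡ {v = v} c) = =AC-∣ˡ (eraseD v) (eraseD-resp-ACRewrite c)
eraseD-resp-ACRewrite (∣-congʳ {v = v} c) = =AC-∣ʳ (eraseD v) (eraseD-resp-ACRewrite c)
eraseD-resp-ACRewrite (D-congˡ _) = ε
eraseD-resp-ACRewrite (D-congʳ c) = eraseD-resp-ACRewrite c
eraseD-resp-ACRewrite c@(E-cong _) = ACRewrite⇒=AC c
eraseD-resp-ACRewrite c@(s-cong _) = ACRewrite⇒=AC c
eraseD-resp-ACRewrite c@(A-congˡ _) = ACRewrite⇒=AC c
eraseD-resp-ACRewrite c@(A-congʳ _) = ACRewrite⇒=AC c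
eraseD-resp-ACRewrite c@(B-congˡ _) = ACRewrite⇒=AC c
eraseD-resp-ACRewrite c@(B-congʳ _) = ACRewrite⇒=AC c
eraseD-resp-ACRewrite c@(C-congˡ _) = ACRewrite⇒=AC c
eraseD-resp-ACRewrite c@(C-congʳ _) = ACRewrite⇒=AC c

data CMark : Term → Set where
  C-mark : ∀ {k q} → Numeral k → Pure q → CMark (C k q)
  E-mark : ∀ {q} → Pure q → CMark (E q)

CMark-resp-ACRewrite : ∀ {t u} → ACRewrite t u → CMark t → CMark u
CMark-resp-ACRewrite (C-congˡ c) (C-mark k _) = ⊥-elim (Numeral-AC-normal k c)
CMark-resp-ACRewrite (C-congʳ c) (C-mark k p) = C-mark k (Pure-resp-ACRewrite c p)
CMark-resp-ACRewrite (E-cong c) (E-mark p) = E-mark (Pure-resp-ACRewrite c p)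
CMark-resp-ACRewrite (base (inj₁ ())) (C-mark _ _)
CMark-resp-ACRewrite (base (inj₂ ())) (C-mark _ _)
CMark-resp-ACRewrite (base (inj₁ ())) (E-mark _)
CMark-resp-ACRewrite (base (inj₂ ())) (E-mark _)

Pure-expandC : ∀ {t} → Marked CMark t → Pure (expandC t)
Pure-expandC {C _ q} (C-mark k p) = Pure-copies k (subst Pure (sym (expandC-Pure p)) p)
Pure-expandC {E _} (E-mark p) = subst Pure (sym (expandC-Pure p)) p
Pure-expandC {I t} m = pI (Pure-expandC {t} m)
Pure-expandC {a ∣ b} (inj₁ (m , pb)) = p∣ (Pure-expandC {a} m) (subst Pure (sym (expandC-Pure pb)) pb)
Pure-expandC {a ∣ b} (inj₂ (pa , m)) = p∣ (subst Pure (sym (expandC-Pure pa)) pa) (Pure-expandC {b} m)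

expandC-Pure-resp-ACRewrite : ∀ {t u} → Pure t → ACRewrite t u → expandC t =AC expandC u
expandC-Pure-resp-ACRewrite p c =
  subst₂ _=AC_ (sym (expandC-Pure p)) (sym (expandC-Pure (Pure-resp-ACRewrite c p))) (ACRewrite⇒=AC c)

-- Unlike eraseD, expandC is AC-invariant only on marked terms: it needs the k of C(k, q) to be a numeral.
expandC-resp-ACRewrite : ∀ {t u} → Marked CMark t → ACRewrite t u → expandC t =AC expandC u
expandC-resp-ACRewrite _ (base (inj₁ (assoc _ _ _))) = ACRewrite⇒=AC (base (inj₁ (assoc _ _ _)))
expandC-resp-ACRewrite _ (base (inj₁ (comm _ _))) = ACRewrite⇒=AC (base (inj₁ (comm _ _)))
expandC-resp-ACRewrite _ (base (inj₂ (assoc _ _ _))) = ACRewrite⇒=AC (base (inj₂ (assoc _ _ _)))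
expandC-resp-ACRewrite _ (base (inj₂ (comm _ _))) = ACRewrite⇒=AC (base (inj₂ (comm _ _)))
expandC-resp-ACRewrite m (I-cong c) = =AC-cong I I-cong (expandC-resp-ACRewrite m c)
expandC-resp-ACRewrite (inj₁ (m , _)) (∣-congˡ {v = v} c) = =AC-∣ˡ (expandC v) (expandC-resp-ACRewrite m c)
expandC-resp-ACRewrite (inj₂ (p , _)) (∣-congˡ {v = v} c) = =AC-∣ˡ (expandC v) (expandC-Pure-resp-ACRewrite p c)
expandC-resp-ACRewrite (inj₁ (_ , p)) (∣-congʳ {v = v} c) = =AC-∣ʳ (expandC v) (expandC-Pure-resp-ACRewrite p c)
expandC-resp-ACRewrite (inj₂ (_ , m)) (∣-congʳ {v = v} c) = =AC-∣ʳ (expandC v) (expandC-resp-ACRewrite m c)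
expandC-resp-ACRewrite (C-mark k _) (C-congˡ c) = ⊥-elim (Numeral-AC-normal k c)
expandC-resp-ACRewrite (C-mark k p) (C-congʳ c) = copies-resp-=AC k (expandC-Pure-resp-ACRewrite p c)
expandC-resp-ACRewrite (E-mark p) (E-cong c) = expandC-Pure-resp-ACRewrite p c

ascend : ∀ {t t'} → Marked CMark t → ℋRewrite t t' → Marked CMark t' × expandC t' ≡ expandC t
ascend (C-mark _ p) (base (r4 _)) = E-mark p , refl
ascend (C-mark (num-s k) p) (base (r5 _ _)) = inj₂ (p , C-mark k p) , refl
ascend (inj₁ (E-mark px , py)) (base (r6 _ _)) = E-mark (pI (p∣ px py)) , refl
ascend (inj₂ (() , _)) (base (r6 _ _))
ascend (E-mark p) (base (r7 _)) = E-mark (pI p) , refl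
ascend m (I-cong c) with ascend m c
... | m' , e = m' , cong I e
ascend {_ ∣ v} (inj₁ (m , p)) (∣-congˡ c) with ascend m c
... | m' , e = inj₁ (m' , p) , cong (_∣ expandC v) e
ascend (inj₂ (p , _)) (∣-congˡ c) = ⊥-elim (Pure-ℋ-normal p c)
ascend (inj₁ (_ , p)) (∣-congʳ c) = ⊥-elim (Pure-ℋ-normal p c)
ascend {v ∣ _} (inj₂ (p , m)) (∣-congʳ c) with ascend m c
... | m' , e = inj₂ (p , m') , cong (expandC v ∣_) e
ascend (E-mark p) (E-cong c) = ⊥-elim (Pure-ℋ-normal p c)
ascend (C-mark k _) (C-congˡ c) = ⊥-elim (Numeral-ℋ-normal k c)
ascend (C-mark _ p) (C-congʳ c) = ⊥-elim (Pure-ℋ-normal p c)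

data InArg (R : Term → Term → Set) (F : Term → Term) (X : Term) : Term → Set where
  in-arg : ∀ {X'} → R X X' → InArg R F X (F X')

A-resp-ACRewrite : ∀ {k X u} → Numeral k → ACRewrite (A k X) u → InArg ACRewrite (A k) X u
A-resp-ACRewrite _ (base (inj₁ ()))
A-resp-ACRewrite _ (base (inj₂ ()))
A-resp-ACRewrite k (A-congˡ c) = ⊥-elim (Numeral-AC-normal k c)
A-resp-ACRewrite _ (A-congʳ c) = in-arg c

B-resp-ACRewrite : ∀ {k X u} → Numeral k → ACRewrite (B k X) u → InArg ACRewrite (B k) X u
B-resp-ACRewrite _ (base (inj₁ ()))
B-resp-ACRewrite _ (base (inj₂ ()))
B-resp-ACRewrite k (B-congˡ c) = ⊥-elim (Numeral-AC-normal k c)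
B-resp-ACRewrite _ (B-congʳ c) = in-arg c

A-ℋRewrite : ∀ {k X u} → Numeral k → ℋRewrite (A k X) u → ℋ-Root (A k X) u ⊎ InArg ℋRewrite (A k) X u
A-ℋRewrite _ (base r) = inj₁ r
A-ℋRewrite k (A-congˡ c) = ⊥-elim (Numeral-ℋ-normal k c)
A-ℋRewrite _ (A-congʳ c) = inj₂ (in-arg c)

B-ℋRewrite : ∀ {k X u} → Numeral k → ℋRewrite (B k X) u → ℋ-Root (B k X) u ⊎ InArg ℋRewrite (B k) X u
B-ℋRewrite _ (base r) = inj₁ r
B-ℋRewrite k (B-congˡ c) = ⊥-elim (Numeral-ℋ-normal k c)
B-ℋRewrite _ (B-congʳ c) = inj₂ (in-arg c)

data DescentRoot : Term → Set where
  at-D : ∀ {k w} → DescentRoot (D k w)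
  at-I : ∀ {t} → DescentRoot (I t)

DescentRoot-resp-ACRewrite : ∀ {t u} → ACRewrite t u → DescentRoot t → DescentRoot u
DescentRoot-resp-ACRewrite (D-congˡ _) at-D = at-D
DescentRoot-resp-ACRewrite (D-congʳ _) at-D = at-D
DescentRoot-resp-ACRewrite (I-cong _) at-I = at-I
DescentRoot-resp-ACRewrite (base (inj₁ ())) at-D
DescentRoot-resp-ACRewrite (base (inj₂ ())) at-D
DescentRoot-resp-ACRewrite (base (inj₁ ())) at-I
DescentRoot-resp-ACRewrite (base (inj₂ ())) at-I

data I-rooted : Term → Set where
  I-root : ∀ {t} → I-rooted (I t)

s-injective : ∀ {a b} → s a ≡ s b → a ≡ b
s-injective refl = refl

sⁿ0-injective : ∀ {a b} → sⁿ0 a ≡ sⁿ0 b → a ≡ b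
sⁿ0-injective {zero} {zero} _ = refl
sⁿ0-injective {suc a} {suc b} e = cong suc (sⁿ0-injective (s-injective e))

A-injective : ∀ {k k' X X'} → A k X ≡ A k' X' → k ≡ k' × X ≡ X'
A-injective refl = refl , refl

module Simulation (n : ℕ) (H : Term) where

  Successive : Term → Set
  Successive Y = Σ Hydra λ T → Σ Hydra λ T' → Encodes H T × Encodes Y T' × BattleStep n T T'

  Successive-resp-=AC : ∀ {Y Y'} → Y =AC Y' → Successive Y → Successive Y'
  Successive-resp-=AC Y≈Y' (T , T' , H≈T , Y≈T' , step) = T , T' , H≈T , =AC-sym Y≈Y' ◅◅ Y≈T' , step

  grow-first : ∀ vs ys → InnerStep n (node (node (leaf ∷ vs) ∷ ys)) (node (replicate (2 + n) (node vs) ++ ys))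
  grow-first vs ys =
    subst (λ k → InnerStep n (node (node (leaf ∷ vs) ∷ ys)) (node (replicate k (node vs) ++ ys)))
          (+-comm n 2) (grow [] ys [] vs)

  grow-copies : ∀ q vs ys → decodeChildren q ≡ node vs ∷ [] →
    InnerStep n (node (node (leaf ∷ vs) ∷ ys)) (node (decodeChildren (copies (sⁿ0 (suc n)) q) ++ ys))
  grow-copies q vs ys e =
    subst (λ cs → InnerStep n (node (node (leaf ∷ vs) ∷ ys)) (node (cs ++ ys)))
          (sym (decodeChildren-copies (suc n) e)) (grow-first vs ys)

  grow-copies-last : ∀ q vs → decodeChildren q ≡ node vs ∷ [] →
    InnerStep n (node (node (leaf ∷ vs) ∷ [])) (node (decodeChildren (copies (sⁿ0 (suc n)) q)))
  grow-copies-last q vs e =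
    subst (λ cs → InnerStep n (node (node (leaf ∷ vs) ∷ [])) (node cs))
          (++-identityʳ _) (grow-copies q vs [] e)

  rule10-grows : ∀ {x y} → Pure x → Pure y →
    InnerStep n (decode (I (I (h ∣ eraseD x) ∣ eraseD y)))
                (decode (I (copies (sⁿ0 (suc n)) (I (expandC x)) ∣ expandC y)))
  rule10-grows {x} px py rewrite eraseD-Pure px | eraseD-Pure py | expandC-Pure px | expandC-Pure py =
    grow-copies (I x) _ _ refl

  rule11-grows : ∀ {x} → Pure x →
    InnerStep n (decode (I (I (h ∣ eraseD x)))) (decode (I (copies (sⁿ0 (suc n)) (I (expandC x)))))
  rule11-grows {x} px rewrite eraseD-Pure px | expandC-Pure px = grow-copies-last (I x) _ refl

  rule12-grows : ∀ {y} → Pure y →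
    InnerStep n (decode (I (I h ∣ eraseD y))) (decode (I (copies (sⁿ0 (suc n)) h ∣ expandC y)))
  rule12-grows py rewrite eraseD-Pure py | expandC-Pure py = grow-copies h [] _ refl

  rule13-grows : InnerStep n (decode (I (I h))) (decode (I (copies (sⁿ0 (suc n)) h)))
  rule13-grows = grow-copies-last h [] refl

  data DMark : Term → Set where
    D-mark : ∀ {x} → Pure x → DMark (D (sⁿ0 (suc n)) (I x))

  DMark-resp-ACRewrite : ∀ {t u} → ACRewrite t u → DMark t → DMark u
  DMark-resp-ACRewrite (D-congˡ c) (D-mark _) = ⊥-elim (Numeral-AC-normal (numeral (suc n)) c)
  DMark-resp-ACRewrite (D-congʳ (I-cong c)) (D-mark p) = D-mark (Pure-resp-ACRewrite c p)
  DMark-resp-ACRewrite (D-congʳ (base (inj₁ ()))) (D-mark _)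
  DMark-resp-ACRewrite (D-congʳ (base (inj₂ ()))) (D-mark _)
  DMark-resp-ACRewrite (base (inj₁ ())) (D-mark _)
  DMark-resp-ACRewrite (base (inj₂ ())) (D-mark _)

  Pure-eraseD-Marked : ∀ {t} → Marked DMark t → Pure (eraseD t)
  Pure-eraseD-Marked {D _ _} (D-mark p) = pI (Pure-eraseD p)
  Pure-eraseD-Marked {I t} m = pI (Pure-eraseD-Marked {t} m)
  Pure-eraseD-Marked {a ∣ b} (inj₁ (m , pb)) = p∣ (Pure-eraseD-Marked {a} m) (Pure-eraseD pb)
  Pure-eraseD-Marked {a ∣ b} (inj₂ (pa , m)) = p∣ (Pure-eraseD pa) (Pure-eraseD-Marked {b} m)

  eraseD-encodes : ∀ {Z} → DescentRoot Z → Marked DMark Z → Encodes (eraseD Z) (decode (eraseD Z))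
  eraseD-encodes at-D (D-mark p) = decode-encodes (Pure-eraseD p)
  eraseD-encodes (at-I {t}) m = decode-encodes (Pure-eraseD-Marked {t} m)

  expandC-encodes : ∀ {Z} → I-rooted Z → Marked CMark Z → Encodes (expandC Z) (decode (expandC Z))
  expandC-encodes (I-root {t}) m = decode-encodes (Pure-expandC {t} m)

  data RootOutcome (t t' : Term) : Set where
    descends : Marked DMark t' → eraseD t' ≡ eraseD t → RootOutcome t t'
    grows : Marked CMark t' → InnerStep n (decode (eraseD t)) (decode (expandC t')) → RootOutcome t t'

  data ChildOutcome (t t' : Term) : Set where
    descends : Marked DMark t' → eraseD t' ≡ eraseD t → ChildOutcome t t'
    grows : ∀ {c c'} → Marked CMark t' → ∀ xs ys →
      decodeChildren (eraseD t) ≡ xs ++ c ∷ ys → decodeChildren (expandC t') ≡ xs ++ c' ∷ ys →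
      InnerStep n c c' → ChildOutcome t t'

  mark-step : ∀ {t t'} → DMark t → ℋ-Root t t' → I-rooted t' × RootOutcome t t'
  mark-step (D-mark (pI px)) (r8 _ _) = I-root , descends (D-mark px) refl
  mark-step (D-mark (p∣ (pI px) py)) (r9 _ _ _) = I-root , descends (inj₁ (D-mark px , py)) refl
  mark-step (D-mark (p∣ (pI (p∣ ph px)) py)) (r10 _ _ _) =
    I-root , grows (inj₁ (C-mark (numeral (suc n)) (pI px) , py)) (rule10-grows px py)
  mark-step (D-mark (pI (p∣ ph px))) (r11 _ _) =
    I-root , grows (C-mark (numeral (suc n)) (pI px)) (rule11-grows px)
  mark-step (D-mark (p∣ (pI ph) py)) (r12 _ _) =
    I-root , grows (inj₁ (C-mark (numeral (suc n)) ph , py)) (rule12-grows py)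
  mark-step (D-mark (pI ph)) (r13 _) = I-root , grows (C-mark (numeral (suc n)) ph) rule13-grows

  deepen : ∀ {t t'} → ChildOutcome t t' → RootOutcome (I t) (I t')
  deepen (descends m e) = descends m (cong I e)
  deepen (grows m xs ys e e' step) =
    grows m (subst₂ (λ P Q → InnerStep n (node P) (node Q)) (sym e) (sym e') (deeper xs ys step))

  as-child : ∀ {t t'} → decodeChildren (eraseD t) ≡ decode (eraseD t) ∷ [] →
             I-rooted t' × RootOutcome t t' → ChildOutcome t t'
  as-child _ (I-root , descends m e) = descends m e
  as-child e (I-root , grows m step) = grows m [] [] e refl step

  beside-left : ∀ {t t' v} → Pure v → ChildOutcome t t' → ChildOutcome (t ∣ v) (t' ∣ v)
  beside-left {v = v} p (descends m e) = descends (inj₁ (m , p)) (cong (_∣ eraseD v) e)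
  beside-left {v = v} p (grows m xs ys e e' step) =
    grows (inj₁ (m , p)) xs (ys ++ decodeChildren v)
      (split-++ʳ e (cong decodeChildren (eraseD-Pure p)))
      (split-++ʳ e' (cong decodeChildren (expandC-Pure p))) step

  beside-right : ∀ {t t' v} → Pure v → ChildOutcome t t' → ChildOutcome (v ∣ t) (v ∣ t')
  beside-right {v = v} p (descends m e) = descends (inj₂ (p , m)) (cong (eraseD v ∣_) e)
  beside-right {v = v} p (grows m xs ys e e' step) =
    grows (inj₂ (p , m)) (decodeChildren v ++ xs) ys
      (split-++ˡ (cong decodeChildren (eraseD-Pure p)) e)
      (split-++ˡ (cong decodeChildren (expandC-Pure p)) e') step

  descend : ∀ {t t'} → Marked DMark t → ℋRewrite t t' → ChildOutcome t t'
  descend {D _ _} m@(D-mark _) (base r) = as-child refl (mark-step m r)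
  descend (D-mark _) (D-congˡ c) = ⊥-elim (Numeral-ℋ-normal (numeral (suc n)) c)
  descend (D-mark p) (D-congʳ c) = ⊥-elim (Pure-ℋ-normal (pI p) c)
  descend (inj₁ (() , _)) (base (r6 _ _))
  descend (inj₂ (() , _)) (base (r6 _ _))
  descend () (base (r7 _))
  descend m (I-cong c) = as-child refl (I-root , deepen (descend m c))
  descend (inj₁ (m , p)) (∣-congˡ c) = beside-left p (descend m c)
  descend (inj₂ (p , _)) (∣-congˡ c) = ⊥-elim (Pure-ℋ-normal p c)
  descend (inj₁ (_ , p)) (∣-congʳ c) = ⊥-elim (Pure-ℋ-normal p c)
  descend (inj₂ (p , m)) (∣-congʳ c) = beside-right p (descend m c)

  descend-root : ∀ {Z Z'} → DescentRoot Z → Marked DMark Z → ℋRewrite Z Z' →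
                 I-rooted Z' × RootOutcome Z Z'
  descend-root at-D m (base r) = mark-step m r
  descend-root at-D (D-mark _) (D-congˡ c) = ⊥-elim (Numeral-ℋ-normal (numeral (suc n)) c)
  descend-root at-D (D-mark p) (D-congʳ c) = ⊥-elim (Pure-ℋ-normal (pI p) c)
  descend-root at-I (inj₁ (() , _)) (base (r6 _ _))
  descend-root at-I (inj₂ (() , _)) (base (r6 _ _))
  descend-root at-I () (base (r7 _))
  descend-root at-I m (I-cong c) = I-root , deepen (descend m c)

  data Stage : Term → Set where
    start : ∀ {X} → Pure X → H =AC X → Stage (A (sⁿ0 n) X)
    finish : ∀ {Y} → Pure Y → Successive Y → Stage (A (sⁿ0 (suc n)) Y)
    descending : ∀ {Z} → Marked DMark Z → DescentRoot Z → H =AC eraseD Z → Stage (B (sⁿ0 n) Z)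
    ascending : ∀ {Z} → Marked CMark Z → Successive (expandC Z) → Stage (B (sⁿ0 n) Z)
    overshot-A : ∀ {m X} → 2 + n ≤ m → Stage (A (sⁿ0 m) X)
    overshot-B : ∀ {m Z} → 1 + n ≤ m → Stage (B (sⁿ0 m) Z)

  Stage-resp-ACRewrite : ∀ {t u} → Stage t → ACRewrite t u → Stage u
  Stage-resp-ACRewrite (start p H≈X) c with A-resp-ACRewrite (numeral n) c
  ... | in-arg c' = start (Pure-resp-ACRewrite c' p) (H≈X ◅◅ ACRewrite⇒=AC c')
  Stage-resp-ACRewrite (finish p g) c with A-resp-ACRewrite (numeral (suc n)) c
  ... | in-arg c' = finish (Pure-resp-ACRewrite c' p) (Successive-resp-=AC (ACRewrite⇒=AC c') g)
  Stage-resp-ACRewrite (descending m r H≈Z) c with B-resp-ACRewrite (numeral n) c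
  ... | in-arg c' = descending (Marked-resp-ACRewrite DMark-resp-ACRewrite c' m)
                               (DescentRoot-resp-ACRewrite c' r) (H≈Z ◅◅ eraseD-resp-ACRewrite c')
  Stage-resp-ACRewrite (ascending m g) c with B-resp-ACRewrite (numeral n) c
  ... | in-arg c' = ascending (Marked-resp-ACRewrite CMark-resp-ACRewrite c' m)
                              (Successive-resp-=AC (expandC-resp-ACRewrite m c') g)
  Stage-resp-ACRewrite (overshot-A {m} le) c with A-resp-ACRewrite (numeral m) c
  ... | in-arg _ = overshot-A le
  Stage-resp-ACRewrite (overshot-B {m} le) c with B-resp-ACRewrite (numeral m) c
  ... | in-arg _ = overshot-B le

  Stage-resp-ℋRewrite : ∀ {t u} → Stage t → ℋRewrite t u → Stage u
  Stage-resp-ℋRewrite (start p H≈X) c with A-ℋRewrite (numeral n) c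
  ... | inj₂ (in-arg c') = ⊥-elim (Pure-ℋ-normal p c')
  ... | inj₁ (r1 _) = finish ph (node (leaf ∷ []) , leaf , H≈X , ε , root-head [] [])
  ... | inj₁ (r2 _ x) with p
  ...   | pI (p∣ ph px) =
    finish (pI px) (decode (I (h ∣ x)) , decode (I x) , H≈X ◅◅ decode-encodes (p∣ ph px) ,
                    decode-encodes px , root-head [] (decodeChildren x))
  Stage-resp-ℋRewrite (start p H≈X) c | inj₁ (r3 _ _) with p
  ... | pI px = descending (D-mark px) at-D (subst (H =AC_) (sym (cong I (eraseD-Pure px))) H≈X)
  Stage-resp-ℋRewrite (finish p _) c with A-ℋRewrite (numeral (suc n)) c
  ... | inj₂ (in-arg c') = ⊥-elim (Pure-ℋ-normal p c')
  ... | inj₁ (r1 _) = overshot-A ≤-refl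
  ... | inj₁ (r2 _ _) = overshot-A ≤-refl
  ... | inj₁ (r3 _ _) = overshot-B ≤-refl
  Stage-resp-ℋRewrite (descending m r H≈Z) c with B-ℋRewrite (numeral n) c
  ... | inj₁ (r14 _ _) with m
  ...   | ()
  Stage-resp-ℋRewrite (descending {Z} m r H≈Z) c | inj₂ (in-arg {Z'} c') with descend-root r m c'
  ... | I-root , descends m' e = descending m' at-I (subst (H =AC_) (sym e) H≈Z)
  ... | root , grows m' step =
    ascending m' (decode (eraseD Z) , decode (expandC Z') ,
                  H≈Z ◅◅ eraseD-encodes r m , expandC-encodes root m' , inner step)
  Stage-resp-ℋRewrite (ascending m g) c with B-ℋRewrite (numeral n) c
  ... | inj₁ (r14 _ _) with m
  ...   | E-mark p = finish p (subst Successive (expandC-Pure p) g)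
  Stage-resp-ℋRewrite (ascending m g) c | inj₂ (in-arg c') with ascend m c'
  ... | m' , e = ascending m' (subst Successive (sym e) g)
  Stage-resp-ℋRewrite (overshot-A {m} le) c with A-ℋRewrite (numeral m) c
  ... | inj₂ (in-arg _) = overshot-A le
  ... | inj₁ (r1 _) = overshot-A (m≤n⇒m≤1+n le)
  ... | inj₁ (r2 _ _) = overshot-A (m≤n⇒m≤1+n le)
  ... | inj₁ (r3 _ _) = overshot-B (≤-trans (n≤1+n _) le)
  Stage-resp-ℋRewrite (overshot-B {m} le) c with B-ℋRewrite (numeral m) c
  ... | inj₂ (in-arg _) = overshot-B le
  ... | inj₁ (r14 _ _) = overshot-A (s≤s le)

  Stage-resp-=AC : ∀ {t u} → Stage t → t =AC u → Stage u
  Stage-resp-=AC st ε = st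
  Stage-resp-=AC st (c ◅ cs) = Stage-resp-=AC (Stage-resp-ACRewrite st (ACStep⇒ACRewrite c)) cs

  Stage-resp-⟶* : ∀ {t u} → Stage t → t ⟶*[ ℋ /AC] u → Stage u
  Stage-resp-⟶* st ε = st
  Stage-resp-⟶* st ((_ , _ , t≈ , r , ≈u) ◅ rs) =
    Stage-resp-⟶* (Stage-resp-=AC (Stage-resp-ℋRewrite (Stage-resp-=AC st t≈) (CC-map RootStep⇒ℋ-Root r)) ≈u)
                  rs

  Stage⇒Successive : ∀ {t Y} → Stage t → t ≡ A (sⁿ0 (suc n)) Y → Successive Y
  Stage⇒Successive (start _ _) e = ⊥-elim (1+n≢n (sym (sⁿ0-injective (proj₁ (A-injective e)))))
  Stage⇒Successive (finish _ g) e = subst Successive (proj₂ (A-injective e)) g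
  Stage⇒Successive (overshot-A le) e with sⁿ0-injective (proj₁ (A-injective e))
  ... | refl = ⊥-elim (1+n≰n le)

theorem3p11 : (H H' : Term) (n : ℕ) →
    Σ Hydra (λ T → Encodes H T) →
    Σ Hydra (λ T' → Encodes H' T') →
    A (sⁿ0 n) H ⟶*[ ℋ /AC] A (sⁿ0 (suc n)) H' →
    Σ Hydra (λ T → Σ Hydra (λ T' →
      Encodes H T × Encodes H' T' × BattleStep n T T'))
-- That H' encodes a Hydra need not be assumed: it is part of what the simulation yields.
theorem3p11 H H' n (T , H≈T) _ H⟶*H' = Stage⇒Successive (Stage-resp-⟶* (start H-pure ε) H⟶*H') refl
  where
  open Simulation n H
  H-pure : Pure H
  H-pure = Pure-resp-=AC (=AC-sym H≈T) (enc-Pure T)
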